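{- Let $(X,\mathcal S)$ be a \textsc{Set Cover} instance with $|X|=n$, and let $\mathcal C\subseteq\mathcal S$ be a feasible solution (i.e., $\bigcup_{S\in\mathcal C}S=X$). Then there is an ordering $S_1,\dots,S_k$ of the cover-sets in $\mathcal C$ such that $\big|S_i\setminus\bigcup_{j=1}^{i'-1}S_j\big|\le\frac{n}{i'}$ for all $1\le i'\le i\le k$.
   Context: A \textsc{Set Cover} instance consists of a finite universe $X$ and a collection $\mathcal S$ of subsets of $X$ (cover-sets). -}

module Defs where

open import Data.Nat using (ℕ; _≤_; _*_; _∸_; suc)
open import Data.Fin using (Fin; toℕ)
open import Data.Fin.Subset as S using (Subset; ⋃; _─_; ∣_∣)
open import Data.List using (List; length; lookup; take)
open import Data.List.Relation.Unary.Any using (Any)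
open import Data.List.Relation.Unary.All using (All)
open import Data.List.Membership.Propositional as L using ()
open import Data.Product using (_×_)

SubCollection : ∀ {n} → List (Subset n) → List (Subset n) → Set
SubCollection 𝒞 𝒮 = All (L._∈ 𝒮) 𝒞

Feasible : ∀ {n} → List (Subset n) → Set
Feasible {n} 𝒞 = (x : Fin n) → x S.∈ ⋃ 𝒞

-- Ordering property: for the ordered list σ = S₁,…,S_k (0-indexed position i),
-- for all 1 ≤ i' ≤ i+1 :  |S_{i+1} ∖ ⋃_{j < i'} S_j| ≤ n / i',
-- stated multiplicatively (|…| * i' ≤ n), which is equivalent over the rationals.
GoodOrdering : ∀ n → List (Subset n) → Set
GoodOrdering n σ =
  (i : Fin (length σ)) (i' : ℕ) → 1 ≤ i' → i' ≤ suc (toℕ i) →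
  ∣ lookup σ i ─ ⋃ (take (i' ∸ 1) σ) ∣ * i' ≤ n

-- Order the sets greedily, always taking a set that covers the most not yet covered
-- elements.  The first i' chosen sets each had gain at least |S ∖ ⋃_{j<i'} S_j| for every
-- later S (gains only shrink as coverage grows), and their gains add up to the size of
-- their union, which is at most n.  Hence i' · |S_i ∖ ⋃_{j<i'} S_j| ≤ n.
module Submission where

open import Defs
open import Data.Fin.Subset using (Subset)
open import Data.List using (List)
open import Data.Nat using (ℕ)
open import Data.List.Relation.Unary.Unique.Propositional using (Unique)
open import Data.List.Relation.Binary.Permutation.Propositional using (_↭_)
open import Data.Product using (Σ; _×_)

open import Data.Bool using (true; false)
open import Data.Vec using ([]; _∷_)
open import Data.Fin using (Fin; suc; toℕ)
open import Data.Fin.Subset using (⊥; _∪_; _─_; ∣_∣; ⋃)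
open import Data.Fin.Subset.Properties
  using (∪-assoc; ∪-identityˡ; ∪-identityʳ; ∣p∣≤n; ∣p─q∣≤∣p∣; p─q─r≡p─q∪r)
open import Data.List using ([]; _∷_; length; lookup; take)
open import Data.List.Membership.Propositional.Properties using (∈-lookup)
open import Data.List.Relation.Unary.All as All using (All; []; _∷_)
open import Data.List.Relation.Binary.Permutation.Propositional as ↭ using (prep; swap)
open import Data.List.Relation.Binary.Permutation.Propositional.Properties
  using (All-resp-↭; ↭-length)
open import Data.Nat using (suc; _+_; _*_; _≤_; z≤n; s≤s; _≤?_)
open import Data.Nat.Properties
open import Data.Product using (_,_; ∃₂)
open import Relation.Nullary using (yes; no)
open import Relation.Binary.PropositionalEquality

∣p∪q∣≡∣p∣+∣q─p∣ : ∀ {n} (p q : Subset n) → ∣ p ∪ q ∣ ≡ ∣ p ∣ + ∣ q ─ p ∣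
∣p∪q∣≡∣p∣+∣q─p∣ []          []          = refl
∣p∪q∣≡∣p∣+∣q─p∣ (true ∷ p)  (_ ∷ q)     = cong suc (∣p∪q∣≡∣p∣+∣q─p∣ p q)
∣p∪q∣≡∣p∣+∣q─p∣ (false ∷ p) (true ∷ q)  = trans (cong suc (∣p∪q∣≡∣p∣+∣q─p∣ p q)) (sym (+-suc _ _))
∣p∪q∣≡∣p∣+∣q─p∣ (false ∷ p) (false ∷ q) = ∣p∪q∣≡∣p∣+∣q─p∣ p q

∣p─q∪r∣≤∣p─q∣ : ∀ {n} (p q r : Subset n) → ∣ p ─ (q ∪ r) ∣ ≤ ∣ p ─ q ∣
∣p─q∪r∣≤∣p─q∣ p q r = subst (λ x → ∣ x ∣ ≤ ∣ p ─ q ∣) (p─q─r≡p─q∪r p q r) (∣p─q∣≤∣p∣ (p ─ q) r)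

extract-max : ∀ {a} {A : Set a} (f : A → ℕ) (x : A) (xs : List A) →
  ∃₂ λ m rest → (m ∷ rest ↭ x ∷ xs) × All (λ y → f y ≤ f m) rest
extract-max f x [] = x , [] , ↭.↭-refl , []
extract-max f x (y ∷ ys) with extract-max f y ys
... | m , rest , m∷rest↭ , bounded with f m ≤? f x
...   | yes fm≤fx = x , m ∷ rest , prep x m∷rest↭ ,
                    fm≤fx ∷ All.map (λ fy≤fm → ≤-trans fy≤fm fm≤fx) bounded
...   | no fm≰fx  = m , x ∷ rest , ↭.↭-trans (swap m x ↭.↭-refl) (prep x m∷rest↭) ,
                    ≰⇒≥ fm≰fx ∷ bounded

module _ {n : ℕ} where

  gain : Subset n → Subset n → ℕ
  gain U S = ∣ S ─ U ∣

  data Greedy : Subset n → List (Subset n) → Set where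
    done : ∀ {U} → Greedy U []
    pick : ∀ {U s σ} → All (λ S → gain U S ≤ gain U s) σ → Greedy (U ∪ s) σ →
           Greedy U (s ∷ σ)

  -- k is fuel: the recursion is on the rest left by extract-max, not on a subterm of L.
  greedy-ordering : ∀ k (U : Subset n) (L : List (Subset n)) → length L ≡ k →
    Σ (List (Subset n)) λ σ → (σ ↭ L) × Greedy U σ
  greedy-ordering _       U []       _    = [] , ↭.↭-refl , done
  greedy-ordering (suc k) U (x ∷ xs) |L|≡ with extract-max (gain U) x xs
  ... | s , rest , s∷rest↭ , bounded with greedy-ordering k (U ∪ s) rest |rest|≡k
    where
    |rest|≡k : length rest ≡ k
    |rest|≡k = suc-injective (trans (↭-length s∷rest↭) |L|≡)
  ... | σ , σ↭rest , greedy =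
    s ∷ σ , ↭.↭-trans (prep s σ↭rest) s∷rest↭ ,
    pick (All-resp-↭ (↭.↭-sym σ↭rest) bounded) greedy

  -- The invariant after m greedy picks covering U: each pick gained at least gain U S for
  -- every remaining S, and the gains of the picks sum to |U|.
  Balanced : Subset n → ℕ → List (Subset n) → Set
  Balanced U m = All (λ S → gain U S * m ≤ ∣ U ∣)

  balanced-zero : ∀ U L → Balanced U 0 L
  balanced-zero U = All.universal λ S → subst (_≤ ∣ U ∣) (sym (*-zeroʳ (gain U S))) z≤n

  picked-bound : ∀ {U s σ m} → All (λ S → gain U S ≤ gain U s) σ → Balanced U m (s ∷ σ) →
    All (λ S → gain U S * suc m ≤ ∣ U ∪ s ∣) (s ∷ σ)
  picked-bound {U} {s} {m = m} bounded (b ∷ bs) =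
    add-pick s ≤-refl b ∷ All.zipWith (λ {S} (≤s , b) → add-pick S ≤s b) (bounded , bs)
    where
    open ≤-Reasoning
    add-pick : ∀ S → gain U S ≤ gain U s → gain U S * m ≤ ∣ U ∣ → gain U S * suc m ≤ ∣ U ∪ s ∣
    add-pick S ≤s b = begin
      gain U S * suc m        ≡⟨ *-suc (gain U S) m ⟩
      gain U S + gain U S * m ≤⟨ +-mono-≤ ≤s b ⟩
      gain U s + ∣ U ∣        ≡⟨ +-comm (gain U s) ∣ U ∣ ⟩
      ∣ U ∣ + gain U s        ≡⟨ ∣p∪q∣≡∣p∣+∣q─p∣ U s ⟨
      ∣ U ∪ s ∣               ∎

  balanced-step : ∀ {U s σ m} → All (λ S → gain U S ≤ gain U s) σ → Balanced U m (s ∷ σ) →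
    Balanced (U ∪ s) (suc m) σ
  balanced-step {U} {s} {m = m} bounded bs =
    All.map (λ {S} → ≤-trans (*-monoˡ-≤ (suc m) (∣p─q∪r∣≤∣p─q∣ S U s)))
            (All.tail (picked-bound bounded bs))

  greedy-bound : ∀ {U σ m} → Greedy U σ → Balanced U m σ →
    (i : Fin (length σ)) (t : ℕ) → t ≤ toℕ i →
    gain (U ∪ ⋃ (take t σ)) (lookup σ i) * suc (m + t) ≤ n
  greedy-bound {U} {s ∷ _} {m} (pick bounded _) bs i 0 _
    rewrite ∪-identityʳ U | +-identityʳ m =
    ≤-trans (All.lookup (picked-bound bounded bs) (∈-lookup i)) (∣p∣≤n (U ∪ s))
  greedy-bound {U} {s ∷ σ} {m} (pick bounded greedy) bs (suc j) (suc t) (s≤s t≤j) =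
    subst₂ (λ V k → gain V (lookup σ j) * k ≤ n)
      (∪-assoc U s (⋃ (take t σ))) (cong suc (sym (+-suc m t)))
      (greedy-bound greedy (balanced-step bounded bs) j t t≤j)

lemma11 : (n : ℕ) → (𝒮 𝒞 : List (Subset n)) → Unique 𝒞 → SubCollection 𝒞 𝒮 → Feasible 𝒞 →
    Σ (List (Subset n)) (λ σ → (σ ↭ 𝒞) × GoodOrdering n σ)
lemma11 n _ 𝒞 _ _ _ with greedy-ordering (length 𝒞) ⊥ 𝒞 refl
... | σ , σ↭𝒞 , greedy = σ , σ↭𝒞 , good
  where
  good : GoodOrdering n σ
  good i (suc t) _ (s≤s t≤i) =
    subst (λ V → ∣ lookup σ i ─ V ∣ * suc t ≤ n) (∪-identityˡ (⋃ (take t σ)))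
      (greedy-bound greedy (balanced-zero ⊥ σ) i t t≤i)
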